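{- Let $x$ be a variable and let $t\in\mathrm{CL}(\mathcal{B})$ be $T$-normal. Then $[x]_T t=[x]_{T'}t$ (syntactic identity).
   Context: Lambda-terms are considered up to $\alpha$-equivalence; $\mathrm{FV}(t)$ is the set of free variables of $t$. Fix the combinators $\mathsf{S}=\lambda xyz.xz(yz)$, $\mathsf{K}=\lambda xy.x$, $\mathsf{I}=\lambda x.x$, $\mathsf{B}=\lambda xyz.x(yz)$, $\mathsf{C}=\lambda xyz.xzy$, $\mathsf{S}'=\lambda kxyz.k(xz)(yz)$, $\mathsf{B}'=\lambda kxyz.kx(yz)$, $\mathsf{C}'=\lambda kxyz.k(xz)y$. Let $\mathcal{B}=\{\mathsf{S},\mathsf{K},\mathsf{I},\mathsf{B},\mathsf{C},\mathsf{S}',\mathsf{B}',\mathsf{C}'\}$ and let $\mathrm{CL}(\mathcal{B})$ be the set of terms built from variables and elements of $\mathcal{B}$ using only application (left-associative); equality of such terms is syntactic, combinators treated as atoms. A term is $T$-normal if it contains no subterm of the form $\mathsf{K}t_1t_2$, $\mathsf{I}t$, $\mathsf{B}t_1t_2t_3$ or $\mathsf{B}'t_1t_2t_3t_4$. Algorithm $T$: for a variable $x$ and $t\in\mathrm{CL}(\mathcal{B})$, $[x]_T t$ is given by the first applicable equation: (1) $[x]_T t=\mathsf{K}t$ if $x\notin\mathrm{FV}(t)$; (2) $[x]_T x=\mathsf{I}$; (3) $[x]_T (s x)=s$ if $x\notin\mathrm{FV}(s)$; (4) $[x]_T (u x t)=\mathsf{C}ut$ if $x\notin\mathrm{FV}(ut)$;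 (5) $[x]_T (u x t)=\mathsf{S}u([x]_T t)$ if $x\notin\mathrm{FV}(u)$; (6) $[x]_T (u s t)=\mathsf{B}'us([x]_T t)$ if $x\notin\mathrm{FV}(us)$; (7) $[x]_T (u s t)=\mathsf{C}'u([x]_T s)t$ if $x\notin\mathrm{FV}(ut)$; (8) $[x]_T (u s t)=\mathsf{S}'u([x]_T s)([x]_T t)$ if $x\notin\mathrm{FV}(u)$; (9) $[x]_T (s t)=\mathsf{B}s([x]_T t)$ if $x\notin\mathrm{FV}(s)$; (10) $[x]_T (s t)=\mathsf{C}([x]_T s)t$ if $x\notin\mathrm{FV}(t)$; (11) $[x]_T (s t)=\mathsf{S}([x]_T s)([x]_T t)$. Algorithm $T'$: $[x]_{T'}(st)=\mathrm{Opt}(\mathsf{S}([x]_{T'}s)([x]_{T'}t))$; $[x]_{T'}x=\mathsf{I}$; $[x]_{T'}t=\mathsf{K}t$ otherwise (for $t$ a variable other than $x$ or a constant), earlier equations taking precedence, where $\mathrm{Opt}$ is given by the first applicable clause: (1) $\mathrm{Opt}(\mathsf{S}(\mathsf{K}s)(\mathsf{K}t))=\mathsf{K}(st)$; (2) $\mathrm{Opt}(\mathsf{S}(\mathsf{K}s)\mathsf{I})=s$; (3) $\mathrm{Opt}(\mathsf{S}(\mathsf{K}(us))t)=\mathsf{B}'ust$; (4) $\mathrm{Opt}(\mathsf{S}(\mathsf{K}s)t)=\mathsf{B}st$; (5) $\mathrm{Opt}(\mathsf{S}(\mathsf{B}us)(\mathsf{K}t))=\mathsf{C}'ust$; (6)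 $\mathrm{Opt}(\mathsf{S}(\mathsf{B}'u_1u_2s)(\mathsf{K}t))=\mathsf{C}'(u_1u_2)st$; (7) $\mathrm{Opt}(\mathsf{S}s(\mathsf{K}t))=\mathsf{C}st$; (8) $\mathrm{Opt}(\mathsf{S}(\mathsf{B}us)t)=\mathsf{S}'ust$; (9) $\mathrm{Opt}(\mathsf{S}(\mathsf{B}'u_1u_2s)t)=\mathsf{S}'(u_1u_2)st$; (10) $\mathrm{Opt}(\mathsf{S}st)=\mathsf{S}st$. -}

module Defs where

open import Data.Nat using (ℕ; _≡ᵇ_)
open import Data.Bool using (Bool; true; false; if_then_else_; not; _∧_; _∨_)
open import Relation.Nullary using (¬_)

data Comb : Set where
  S K I B C S′ B′ C′ : Comb

infixl 9 _·_
data Term : Set where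
  var  : ℕ → Term
  comb : Comb → Term
  _·_  : Term → Term → Term

pattern `S  = comb S
pattern `K  = comb K
pattern `I  = comb I
pattern `B  = comb B
pattern `C  = comb C
pattern `S′ = comb S′
pattern `B′ = comb B′
pattern `C′ = comb C′

occurs : ℕ → Term → Bool
occurs x (var y)  = y ≡ᵇ x
occurs x (comb c) = false
occurs x (s · t)  = occurs x s ∨ occurs x t

isVar : ℕ → Term → Bool
isVar x (var y) = y ≡ᵇ x
isVar x _       = false

data _⊑_ : Term → Term → Set where
  here  : ∀ {t} → t ⊑ t
  left  : ∀ {u s t} → u ⊑ s → u ⊑ (s · t)
  right : ∀ {u s t} → u ⊑ t → u ⊑ (s · t)

data IsTRedex : Term → Set where
  rK  : ∀ t₁ t₂ → IsTRedex (`K · t₁ · t₂)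
  rI  : ∀ t → IsTRedex (`I · t)
  rB  : ∀ t₁ t₂ t₃ → IsTRedex (`B · t₁ · t₂ · t₃)
  rB′ : ∀ t₁ t₂ t₃ t₄ → IsTRedex (`B′ · t₁ · t₂ · t₃ · t₄)

TNormal : Term → Set
TNormal t = ∀ s → s ⊑ t → ¬ IsTRedex s

mutual
  absT : ℕ → Term → Term
  absT x (var y)  = if y ≡ᵇ x then `I else `K · var y        -- (1),(2)
  absT x (comb c) = `K · comb c                              -- (1)
  absT x (s · t)  = if not (occurs x (s · t)) then `K · (s · t)  -- (1)
                    else absTapp x s t

  -- x ∈ FV(s t): equation (3), then the rest
  absTapp : ℕ → Term → Term → Term
  absTapp x s t = if isVar x t ∧ not (occurs x s) then s      -- (3)
                  else absTapp₂ x s t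

  absTapp₂ : ℕ → Term → Term → Term
  absTapp₂ x (u · s) t =
    if isVar x s ∧ not (occurs x u) ∧ not (occurs x t) then `C · u · t                 -- (4)
    else if isVar x s ∧ not (occurs x u) then `S · u · absT x t                        -- (5)
    else if not (occurs x u) ∧ not (occurs x s) then `B′ · u · s · absT x t           -- (6)
    else if not (occurs x u) ∧ not (occurs x t) then `C′ · u · absT x s · t           -- (7)
    else if not (occurs x u) then `S′ · u · absT x s · absT x t                       -- (8)
    else absT₉ x (u · s) t
  absTapp₂ x s t = absT₉ x s t

  absT₉ : ℕ → Term → Term → Term
  absT₉ x s t =
    if not (occurs x s) then `B · s · absT x t                                         -- (9)
    else if not (occurs x t) then `C · absT x s · t                                    -- (10)
    else `S · absT x s · absT x t                                                      -- (11)

-- Opt (first applicable clause; clause (10) is the identity on S s t,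
-- and Opt is only ever applied to terms of the form S s t)
Opt : Term → Term
Opt (`S · (`K · s) · (`K · t))              = `K · (s · t)       -- (1)
Opt (`S · (`K · s) · `I)                    = s                  -- (2)
Opt (`S · (`K · (u · s)) · t)               = `B′ · u · s · t    -- (3)
Opt (`S · (`K · s) · t)                     = `B · s · t         -- (4)
Opt (`S · (`B · u · s) · (`K · t))          = `C′ · u · s · t    -- (5)
Opt (`S · (`B′ · u₁ · u₂ · s) · (`K · t))   = `C′ · (u₁ · u₂) · s · t  -- (6)
Opt (`S · s · (`K · t))                     = `C · s · t         -- (7)
Opt (`S · (`B · u · s) · t)                 = `S′ · u · s · t    -- (8)
Opt (`S · (`B′ · u₁ · u₂ · s) · t)          = `S′ · (u₁ · u₂) · s · t  -- (9)
Opt t                                       = t                  -- (10)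

absT′ : ℕ → Term → Term
absT′ x (s · t)  = Opt (`S · absT′ x s · absT′ x t)
absT′ x (var y)  = if y ≡ᵇ x then `I else `K · var y
absT′ x (comb c) = `K · comb c

-- For an application s u, both algorithms are driven by where x occurs.
-- When x occurs in s, the equations (4),(5),(7),(8),(10),(11) of T combine the argument
-- with a pair of heads, (C · p, S · p) or (C′ · p · q, S′ · p · q), determined by s alone,
-- choosing the first head exactly when x ∉ FV(u); and Opt, given S ([x]s) ([x]u), selects
-- the same pair, choosing the first head exactly when [x]u = K u. When x occurs only in u,
-- the B/B′ of equations (6),(9) are produced by clauses (3),(4) of Opt. T-normality ensures
-- that the abstractions that occur are never of the forms K t, I, B u s or B′ u₁ u₂ s on
-- which Opt would take another clause.
module Submission where

open import Defs
open import Data.Bool using (true; false; if_then_else_; not; _∨_)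
open import Data.Bool.Properties using (∧-zeroʳ; ∨-conicalˡ; ∨-conicalʳ)
open import Data.Nat using (ℕ)
open import Data.Product using (_×_; _,_; proj₁; proj₂)
open import Function.Base using (it)
open import Relation.Nullary using (¬_)
open import Relation.Binary.PropositionalEquality
open ≡-Reasoning

data KApplied : Term → Set where
  K· : ∀ t → KApplied (`K · t)

data BApplied : Term → Set where
  B·  : ∀ u s → BApplied (`B · u · s)
  B′· : ∀ u₁ u₂ s → BApplied (`B′ · u₁ · u₂ · s)

-- Transparent and Plain exclude the shapes that Opt's patterns look for in the first
-- and in the second argument of S, respectively.
Transparent : Term → Set
Transparent s = ¬ KApplied s × ¬ BApplied s

Plain : Term → Set
Plain t = ¬ KApplied t × t ≢ `I

if-pres : (P : Term → Set) → ∀ c {t e} → P t → P e → P (if c then t else e)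
if-pres P true  pt _  = pt
if-pres P false _  pe = pe

ifK : (Term → Term) → (Term → Term) → Term → Term
ifK f g (`K · t) = f t
ifK f g t        = g t

ifI : Term → (Term → Term) → Term → Term
ifI a g `I = a
ifI a g t  = g t

compose : Term → Term → Term
compose (u₁ · u₂) t = `B′ · u₁ · u₂ · t
compose u         t = `B · u · t

ifK-¬K : ∀ {f g t} → ¬ KApplied t → ifK f g t ≡ g t
ifK-¬K {t = var _}       _  = refl
ifK-¬K {t = comb _}      _  = refl
ifK-¬K {t = var _ · _}   _  = refl
ifK-¬K {t = `S · _}      _  = refl
ifK-¬K {t = `K · t}      ¬K with () ← ¬K (K· t)
ifK-¬K {t = `I · _}      _  = refl
ifK-¬K {t = `B · _}      _  = refl
ifK-¬K {t = `C · _}      _  = refl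
ifK-¬K {t = `S′ · _}     _  = refl
ifK-¬K {t = `B′ · _}     _  = refl
ifK-¬K {t = `C′ · _}     _  = refl
ifK-¬K {t = _ · _ · _}   _  = refl

ifI-≢I : ∀ {a g t} → t ≢ `I → ifI a g t ≡ g t
ifI-≢I {t = var _}  _  = refl
ifI-≢I {t = `S}     _  = refl
ifI-≢I {t = `K}     _  = refl
ifI-≢I {t = `I}     ≢I with () ← ≢I refl
ifI-≢I {t = `B}     _  = refl
ifI-≢I {t = `C}     _  = refl
ifI-≢I {t = `S′}    _  = refl
ifI-≢I {t = `B′}    _  = refl
ifI-≢I {t = `C′}    _  = refl
ifI-≢I {t = _ · _}  _  = refl

compose-plain : ∀ u t → Plain (compose u t)
compose-plain (var _)  _ = (λ ()) , (λ ())
compose-plain (comb _) _ = (λ ()) , (λ ())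
compose-plain (_ · _)  _ = (λ ()) , (λ ())

-- On a term of known shape both sides of each hypothesis of agree-on-shapes
-- evaluate to the same normal form, so instance search closes it with ≡-refl.
instance
  ≡-refl : {A : Set} {x : A} → x ≡ x
  ≡-refl = refl

module _ {f g : Term → Term}
  {{_ : ∀ {y} → f (var y) ≡ g (var y)}}
  {{_ : f `S ≡ g `S}} {{_ : f `K ≡ g `K}} {{_ : f `I ≡ g `I}} {{_ : f `B ≡ g `B}}
  {{_ : f `C ≡ g `C}} {{_ : f `S′ ≡ g `S′}} {{_ : f `B′ ≡ g `B′}} {{_ : f `C′ ≡ g `C′}}
  {{_ : ∀ {y a} → f (var y · a) ≡ g (var y · a)}}
  {{_ : ∀ {a} → f (`S · a) ≡ g (`S · a)}}   {{_ : ∀ {a} → f (`K · a) ≡ g (`K · a)}}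
  {{_ : ∀ {a} → f (`I · a) ≡ g (`I · a)}}   {{_ : ∀ {a} → f (`B · a) ≡ g (`B · a)}}
  {{_ : ∀ {a} → f (`C · a) ≡ g (`C · a)}}   {{_ : ∀ {a} → f (`S′ · a) ≡ g (`S′ · a)}}
  {{_ : ∀ {a} → f (`B′ · a) ≡ g (`B′ · a)}} {{_ : ∀ {a} → f (`C′ · a) ≡ g (`C′ · a)}}
  {{_ : ∀ {p q a} → f (p · q · a) ≡ g (p · q · a)}}
  where

  agree-on-shapes : ∀ t → f t ≡ g t
  agree-on-shapes (var _)     = it
  agree-on-shapes `S          = it
  agree-on-shapes `K          = it
  agree-on-shapes `I          = it
  agree-on-shapes `B          = it
  agree-on-shapes `C          = it
  agree-on-shapes `S′         = it
  agree-on-shapes `B′         = it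
  agree-on-shapes `C′         = it
  agree-on-shapes (var _ · _) = it
  agree-on-shapes (`S · _)    = it
  agree-on-shapes (`K · _)    = it
  agree-on-shapes (`I · _)    = it
  agree-on-shapes (`B · _)    = it
  agree-on-shapes (`C · _)    = it
  agree-on-shapes (`S′ · _)   = it
  agree-on-shapes (`B′ · _)   = it
  agree-on-shapes (`C′ · _)   = it
  agree-on-shapes (_ · _ · _) = it

Opt-K : ∀ s t → Opt (`S · (`K · s) · t) ≡ ifK (λ t′ → `K · (s · t′)) (ifI s (compose s)) t
Opt-K (var _)  = agree-on-shapes
Opt-K (comb _) = agree-on-shapes
Opt-K (_ · _)  = agree-on-shapes

Opt-compose : ∀ u s t → Opt (`S · compose u s · t) ≡ ifK (`C′ · u · s ·_) (`S′ · u · s ·_) t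
Opt-compose (var _)  _ = agree-on-shapes
Opt-compose (comb _) _ = agree-on-shapes
Opt-compose (_ · _)  _ = agree-on-shapes

Opt-transparent : ∀ s → Transparent s → ∀ t → Opt (`S · s · t) ≡ ifK (`C · s ·_) (`S · s ·_) t
Opt-transparent (var _)             _ = agree-on-shapes
Opt-transparent (comb _)            _ = agree-on-shapes
Opt-transparent (var _ · _)         _ = agree-on-shapes
Opt-transparent (`S · _)            _ = agree-on-shapes
Opt-transparent (`K · a)      (¬K , _) with () ← ¬K (K· a)
Opt-transparent (`I · _)            _ = agree-on-shapes
Opt-transparent (`B · _)            _ = agree-on-shapes
Opt-transparent (`C · _)            _ = agree-on-shapes
Opt-transparent (`S′ · _)           _ = agree-on-shapes
Opt-transparent (`B′ · _)           _ = agree-on-shapes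
Opt-transparent (`C′ · _)           _ = agree-on-shapes
Opt-transparent (var _ · _ · _)     _ = agree-on-shapes
Opt-transparent (`S · _ · _)        _ = agree-on-shapes
Opt-transparent (`K · _ · _)        _ = agree-on-shapes
Opt-transparent (`I · _ · _)        _ = agree-on-shapes
Opt-transparent (`B · u · s)  (_ , ¬B) with () ← ¬B (B· u s)
Opt-transparent (`C · _ · _)        _ = agree-on-shapes
Opt-transparent (`S′ · _ · _)       _ = agree-on-shapes
Opt-transparent (`B′ · _ · _)       _ = agree-on-shapes
Opt-transparent (`C′ · _ · _)       _ = agree-on-shapes
Opt-transparent (var _ · _ · _ · _) _ = agree-on-shapes
Opt-transparent (`S · _ · _ · _)    _ = agree-on-shapes
Opt-transparent (`K · _ · _ · _)    _ = agree-on-shapes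
Opt-transparent (`I · _ · _ · _)    _ = agree-on-shapes
Opt-transparent (`B · _ · _ · _)    _ = agree-on-shapes
Opt-transparent (`C · _ · _ · _)    _ = agree-on-shapes
Opt-transparent (`S′ · _ · _ · _)   _ = agree-on-shapes
Opt-transparent (`B′ · u₁ · u₂ · s) (_ , ¬B) with () ← ¬B (B′· u₁ u₂ s)
Opt-transparent (`C′ · _ · _ · _)   _ = agree-on-shapes
Opt-transparent (_ · _ · _ · _ · _) _ = agree-on-shapes

module _ {s t : Term} (n : TNormal (s · t)) where

  normal-left : TNormal s
  normal-left r r⊑s = n r (left r⊑s)

  normal-right : TNormal t
  normal-right r r⊑t = n r (right r⊑t)

  normal-transparent : Transparent s
  normal-transparent = (λ { (K· w) → n _ here (rK w t) })
                     , (λ { (B· u v)       → n _ here (rB u v t)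
                          ; (B′· u₁ u₂ v) → n _ here (rB′ u₁ u₂ v t) })

  normal-plain : Plain s
  normal-plain = proj₁ normal-transparent , λ { refl → n _ here (rI t) }

data Heads : Term → Term → Set where
  CS   : ∀ p → Heads (`C · p) (`S · p)
  C′S′ : ∀ p q → Heads (`C′ · p · q) (`S′ · p · q)

heads-transparent : ∀ {hC hS} → Heads hC hS → ∀ c b v → Transparent (if c then hC · b else hS · v)
heads-transparent (CS _)     c _ _ = if-pres Transparent c ((λ ()) , (λ ())) ((λ ()) , (λ ()))
heads-transparent (C′S′ _ _) c _ _ = if-pres Transparent c ((λ ()) , (λ ())) ((λ ()) , (λ ()))

heads-plain : ∀ {hC hS} → Heads hC hS → ∀ c b v → Plain (if c then hC · b else hS · v)
heads-plain (CS _)     c _ _ = if-pres Plain c ((λ ()) , (λ ())) ((λ ()) , (λ ()))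
heads-plain (C′S′ _ _) c _ _ = if-pres Plain c ((λ ()) , (λ ())) ((λ ()) , (λ ()))

record LeftAbstraction (x : ℕ) (s : Term) : Set where
  field
    {hC hS}   : Term
    heads     : Heads hC hS
    opt       : ∀ t → Opt (`S · absT x s · t) ≡ ifK (hC ·_) (hS ·_) t
    absTapp₂≡ : ∀ t → absTapp₂ x s t ≡ (if not (occurs x t) then hC · t else hS · absT x t)

open LeftAbstraction

module _ {x : ℕ} where

  occurs-isVar : ∀ {t} → isVar x t ≡ true → occurs x t ≡ true
  occurs-isVar {var _} v = v

  isVar-occurs : ∀ {t} → occurs x t ≡ false → isVar x t ≡ false
  isVar-occurs {var _}  o = o
  isVar-occurs {comb _} _ = refl
  isVar-occurs {_ · _}  _ = refl

  absT-notFree : ∀ {t} → occurs x t ≡ false → absT x t ≡ `K · t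
  absT-notFree {var _}  o rewrite o = refl
  absT-notFree {comb _} _ = refl
  absT-notFree {_ · _}  o rewrite o = refl

  absT-var : ∀ {t} → isVar x t ≡ true → absT x t ≡ `I
  absT-var {var _} v rewrite v = refl

  absT-eta : ∀ {s t} → occurs x s ≡ false → isVar x t ≡ true → absT x (s · t) ≡ s
  absT-eta {s} {t} o v rewrite o | occurs-isVar {t} v | v = refl

  absTapp₂-compose : ∀ {s t} → occurs x s ≡ false → absTapp₂ x s t ≡ compose s (absT x t)
  absTapp₂-compose {var _}  o rewrite o = refl
  absTapp₂-compose {comb _} _ = refl
  absTapp₂-compose {u · s}  o
    rewrite ∨-conicalˡ (occurs x u) _ o | ∨-conicalʳ _ (occurs x s) o
          | isVar-occurs {s} (∨-conicalʳ _ _ o) = refl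

  absT-compose : ∀ {s t} → occurs x s ≡ false → occurs x t ≡ true → isVar x t ≡ false →
                 absT x (s · t) ≡ compose s (absT x t)
  absT-compose {s} {t} o o′ v rewrite o | o′ | v = absTapp₂-compose {s} o

  absT-left : ∀ {s t} → occurs x s ≡ true → absT x (s · t) ≡ absTapp₂ x s t
  absT-left {s} {t} o rewrite o | ∧-zeroʳ (isVar x t) = refl

  data Occurrence (s u : Term) : Set where
    nowhere : occurs x s ≡ false → occurs x u ≡ false → Occurrence s u
    inFun   : occurs x s ≡ true → Occurrence s u
    eta     : occurs x s ≡ false → isVar x u ≡ true → Occurrence s u
    inArg   : occurs x s ≡ false → occurs x u ≡ true → isVar x u ≡ false → Occurrence s u

  occurrence : ∀ s u → Occurrence s u
  occurrence s u with occurs x s in os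
  ... | true = inFun os
  ... | false with isVar x u in vu
  ...   | true = eta os vu
  ...   | false with occurs x u in ou
  ...     | true  = inArg os ou vu
  ...     | false = nowhere os ou

  leftAbstraction : ∀ {s} → TNormal s → occurs x s ≡ true → LeftAbstraction x s
  leftAbstraction {var y} _ o = record
    { heads     = CS `I
    ; opt       = λ t → trans (cong (λ a → Opt (`S · a · t)) (absT-var {var y} o))
                              (Opt-transparent `I ((λ ()) , (λ ())) t)
    ; absTapp₂≡ = computation
    }
    where
    computation : ∀ t → absTapp₂ x (var y) t
                      ≡ (if not (occurs x t) then `C · `I · t else `S · `I · absT x t)
    computation t rewrite o = refl
  leftAbstraction {a · b} n o with occurrence a b
  ... | nowhere oa ob with () ← trans (sym o) (cong₂ _∨_ oa ob)
  ... | inFun oa = record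
    { heads     = CS (absT x (a · b))
    ; opt       = Opt-transparent _ transparent
    ; absTapp₂≡ = computation
    }
    where
    L = leftAbstraction (normal-left n) oa

    transparent : Transparent (absT x (a · b))
    transparent = subst Transparent (sym (trans (absT-left {a} {b} oa) (absTapp₂≡ L b)))
                        (heads-transparent (heads L) _ _ _)

    computation : ∀ t → absTapp₂ x (a · b) t
                      ≡ (if not (occurs x t) then `C · absT x (a · b) · t
                                              else `S · absT x (a · b) · absT x t)
    computation t rewrite oa | ∧-zeroʳ (isVar x b) = refl
  ... | eta oa vb = record
    { heads     = CS a
    ; opt       = λ t → trans (cong (λ a′ → Opt (`S · a′ · t)) (absT-eta {a} {b} oa vb))
                              (Opt-transparent a (normal-transparent n) t)
    ; absTapp₂≡ = computation
    }
    where
    computation : ∀ t → absTapp₂ x (a · b) t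
                      ≡ (if not (occurs x t) then `C · a · t else `S · a · absT x t)
    computation t rewrite oa | vb = refl
  ... | inArg oa ob vb = record
    { heads     = C′S′ a (absT x b)
    ; opt       = λ t → trans (cong (λ a′ → Opt (`S · a′ · t)) (absT-compose {a} {b} oa ob vb))
                              (Opt-compose a (absT x b) t)
    ; absTapp₂≡ = computation
    }
    where
    computation : ∀ t → absTapp₂ x (a · b) t
                      ≡ (if not (occurs x t) then `C′ · a · absT x b · t
                                              else `S′ · a · absT x b · absT x t)
    computation t rewrite oa | vb | ob = refl

  absT-plain : ∀ {u} → TNormal u → occurs x u ≡ true → isVar x u ≡ false → Plain (absT x u)
  absT-plain {var _} _ o v with () ← trans (sym o) v
  absT-plain {p · q} n o _ with occurrence p q
  ... | nowhere op oq with () ← trans (sym o) (cong₂ _∨_ op oq)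
  ... | inFun op      = subst Plain (sym (trans (absT-left {p} {q} op) (absTapp₂≡ L q)))
                              (heads-plain (heads L) _ _ _)
    where L = leftAbstraction (normal-left n) op
  ... | eta op vq     = subst Plain (sym (absT-eta {p} {q} op vq)) (normal-plain n)
  ... | inArg op oq vq = subst Plain (sym (absT-compose {p} {q} op oq vq)) (compose-plain p _)

  absT-¬K : ∀ {u} → TNormal u → occurs x u ≡ true → ¬ KApplied (absT x u)
  absT-¬K {var _} _ o rewrite o = λ ()
  absT-¬K {p · q} n o = proj₁ (absT-plain n o refl)

  ifK-absT : ∀ {u} f g → TNormal u →
             ifK f g (absT x u) ≡ (if not (occurs x u) then f u else g (absT x u))
  ifK-absT {u} f g n with occurs x u in o
  ... | false rewrite absT-notFree {u} o = refl
  ... | true  = ifK-¬K (absT-¬K n o)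

  absT-app : ∀ {s u} → TNormal (s · u) → absT x (s · u) ≡ Opt (`S · absT x s · absT x u)
  absT-app {s} {u} n with occurrence s u
  ... | nowhere os ou = begin
    absT x (s · u)                  ≡⟨ absT-notFree {s · u} (cong₂ _∨_ os ou) ⟩
    Opt (`S · (`K · s) · (`K · u))  ≡⟨ cong₂ (λ a b → Opt (`S · a · b))
                                             (absT-notFree os) (absT-notFree ou) ⟨
    Opt (`S · absT x s · absT x u)  ∎
  ... | inFun os = begin
    absT x (s · u)                                            ≡⟨ absT-left {s} {u} os ⟩
    absTapp₂ x s u                                            ≡⟨ absTapp₂≡ L u ⟩
    (if not (occurs x u) then hC L · u else hS L · absT x u)  ≡⟨ ifK-absT _ _ (normal-right n) ⟨
    ifK (hC L ·_) (hS L ·_) (absT x u)                        ≡⟨ opt L (absT x u) ⟨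
    Opt (`S · absT x s · absT x u)                            ∎
    where L = leftAbstraction (normal-left n) os
  ... | eta os vu = begin
    absT x (s · u)                  ≡⟨ absT-eta {s} {u} os vu ⟩
    Opt (`S · (`K · s) · `I)        ≡⟨ cong₂ (λ a b → Opt (`S · a · b))
                                             (absT-notFree os) (absT-var {u} vu) ⟨
    Opt (`S · absT x s · absT x u)  ∎
  ... | inArg os ou vu = begin
    absT x (s · u)                                              ≡⟨ absT-compose {s} {u} os ou vu ⟩
    compose s (absT x u)                                        ≡⟨ ifI-≢I (proj₂ plain) ⟨
    ifI s (compose s) (absT x u)                                ≡⟨ ifK-¬K (proj₁ plain) ⟨
    ifK (λ t′ → `K · (s · t′)) (ifI s (compose s)) (absT x u)   ≡⟨ Opt-K s (absT x u) ⟨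
    Opt (`S · (`K · s) · absT x u)                              ≡⟨ cong (λ a → Opt (`S · a · absT x u))
                                                                        (absT-notFree os) ⟨
    Opt (`S · absT x s · absT x u)                              ∎
    where plain = absT-plain (normal-right n) ou vu

mainTheorem10 : (x : ℕ) (t : Term) → TNormal t → absT x t ≡ absT′ x t
mainTheorem10 x (var _)  _ = refl
mainTheorem10 x (comb _) _ = refl
mainTheorem10 x (s · u)  n = begin
  absT x (s · u)                  ≡⟨ absT-app n ⟩
  Opt (`S · absT x s · absT x u)  ≡⟨ cong₂ (λ a b → Opt (`S · a · b)) (mainTheorem10 x s (normal-left n))
                                                                       (mainTheorem10 x u (normal-right n)) ⟩
  absT′ x (s · u)                 ∎
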